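{- Let $S^p_{n,m}$ denote the $(n,m)$-th entry of the $p$-th power of the infinite lower triangular matrix $\mathcal{S}=(S_{n,m})_{n,m\ge0}$ of Stirling numbers of the second kind. For $p\ge1$ define the higher order Fubini polynomials $F^p_n(x)=\sum_{m=0}^n S^p_{n,m}\,m!\,x^m$. Define power series $\sigma^1(t)=e^t-1$ and $\sigma^p(t)=\sigma^{p-1}(e^t-1)$ for $p>1$. Then for every $p\ge1$, \[\sum_{n=0}^\infty F^p_n(x)\frac{t^n}{n!}=\frac{1}{1-x\,\sigma^p(t)}\] as formal power series in $t$.
   Context: $S_{n,m}$ is the number of partitions of an $n$-set into $m$ nonempty blocks ($S_{n,m}=0$ for $m>n$). -}

module Defs where

open import Data.Nat as ℕ using (ℕ; zero; suc; _!; _≤?_)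
open import Data.Nat.Properties using (_!≢0)
open import Data.Integer using (+_)
open import Data.Rational using (ℚ; 0ℚ; 1ℚ; _+_; _*_; _-_; _/_)
open import Relation.Nullary using (yes; no)

S : ℕ → ℕ → ℕ
S zero    zero    = 1
S zero    (suc m) = 0
S (suc n) zero    = 0
S (suc n) (suc m) = suc m ℕ.* S n (suc m) ℕ.+ S n m

sumℕ : ℕ → (ℕ → ℕ) → ℕ
sumℕ zero    f = f 0
sumℕ (suc n) f = sumℕ n f ℕ.+ f (suc n)

sumℚ : ℕ → (ℕ → ℚ) → ℚ
sumℚ zero    f = f 0
sumℚ (suc n) f = sumℚ n f + f (suc n)

-- Since Spow p is lower triangular, the (n,m) entry of the product
-- is the finite sum over k = 0..n.
Spow : ℕ → ℕ → ℕ → ℕ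
Spow zero    n m with n ℕ.≟ m
... | yes _ = 1
... | no  _ = 0
Spow (suc p) n m = sumℕ n (λ k → Spow p n k ℕ.* S k m)

ℕ→ℚ : ℕ → ℚ
ℕ→ℚ n = + n / 1

inv! : ℕ → ℚ
inv! n = (+ 1 / (n !)) {{n !≢0}}

-- Polynomials in x, represented by their coefficient sequence.
-- Higher order Fubini polynomial F^p_n(x) = Σ_{m=0}^n S^p_{n,m} m! x^m:
-- the coefficient of x^m.
Fubini : ℕ → ℕ → ℕ → ℚ
Fubini p n m with m ≤? n
... | yes _ = ℕ→ℚ (Spow p n m ℕ.* m !)
... | no  _ = 0ℚ

FPS : Set
FPS = ℕ → ℚ

_⊛_ : FPS → FPS → FPS
(f ⊛ g) n = sumℚ n (λ i → f i * g (n ℕ.∸ i))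

one : FPS
one zero    = 1ℚ
one (suc n) = 0ℚ

pow : FPS → ℕ → FPS
pow f zero    = one
pow f (suc k) = f ⊛ pow f k

-- composition f(g(t)), for g with zero constant term:
-- [t^n] f(g(t)) = Σ_{k=0}^n f_k [t^n] g(t)^k
compose : FPS → FPS → FPS
compose f g n = sumℚ n (λ k → f k * pow g k n)

expm1 : FPS
expm1 zero    = 0ℚ
expm1 (suc n) = inv! (suc n)

-- σ^1(t) = e^t - 1,  σ^p(t) = σ^{p-1}(e^t - 1) for p > 1.
-- (σ 0 is unused junk.)
σ : ℕ → FPS
σ zero          = 0ℚ-series
  where 0ℚ-series : FPS
        0ℚ-series _ = 0ℚ
σ (suc zero)    = expm1
σ (suc (suc p)) = compose (σ (suc p)) expm1

-- Formal power series in t whose coefficients are polynomials in x,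
-- i.e. bivariate series:  A n k = [t^n x^k] A.
BiFPS : Set
BiFPS = ℕ → ℕ → ℚ

_⊛₂_ : BiFPS → BiFPS → BiFPS
(A ⊛₂ B) n k = sumℚ n (λ i → sumℚ k (λ j → A i j * B (n ℕ.∸ i) (k ℕ.∸ j)))

one₂ : BiFPS
one₂ zero    zero    = 1ℚ
one₂ _       _       = 0ℚ

FubiniEGF : ℕ → BiFPS
FubiniEGF p n k = Fubini p n k * inv! n

oneMinusXσ : ℕ → BiFPS
oneMinusXσ p n zero          = one₂ n zero
oneMinusXσ p n (suc zero)    = 0ℚ - σ p n
oneMinusXσ p n (suc (suc k)) = 0ℚ

-- Since 1 − x g(t) has inverse Σₖ xᵏ g(t)ᵏ for every power series g, it suffices to show
-- that S^p_{n,m} m!/n! is the coefficient of tⁿ in σᵖ(t)ᵐ.  For p = 1 this is the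
-- exponential generating function of the Stirling numbers: differentiating (eᵗ − 1)^{k+1}
-- gives (k+1)((eᵗ − 1)^{k+1} + (eᵗ − 1)ᵏ), which is their recurrence.  Substituting
-- eᵗ − 1 into σᵖ(t)ᵐ then multiplies the coefficient matrix by 𝒮 on the left, and
-- 𝒮 · 𝒮ᵖ = 𝒮ᵖ · 𝒮 = 𝒮ᵖ⁺¹ because all powers of 𝒮 commute.

module Submission where

open import Defs
open import Data.Nat using (ℕ; _≤_)
open import Relation.Binary.PropositionalEquality using (_≡_)

open import Level using (0ℓ)
open import Data.Nat as ℕ using (zero; suc; _<_; z≤n; s≤s; _∸_; _!; _≤?_; NonZero)
open import Data.Nat.Properties
  using (≤-refl; m≤n⇒m≤1+n; m≤n⇒m<n∨m≡n; <⇒≤; <⇒≢; >⇒≢; ≤∧≢⇒<; ≤-<-trans; <-≤-trans; ≰⇒>;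
         m<n⇒m<1+n; m<n⇒0<n∸m; n∸n≡0; m∸n≤m; m+n∸n≡m; m+[n∸m]≡n; m≤n+m∸n; +-∸-assoc; ∸-+-assoc;
         ∸-monoʳ-<; +-monoʳ-<; +-comm; +-identityʳ; *-identityʳ; *-zeroʳ; _!≢0)
import Data.Integer as ℤ
import Data.Integer.Properties as ℤ
open import Data.Rational using (ℚ; 0ℚ; 1ℚ; _+_; _*_; _-_; _/_; toℚᵘ)
import Data.Rational.Properties as ℚ
open import Data.Rational.Unnormalised as ℚᵘ using (mkℚᵘ; *≡*)
import Data.Rational.Unnormalised.Properties as ℚᵘ
open import Data.Empty using (⊥-elim)
open import Data.Sum using (inj₁; inj₂)
open import Function using (_∘_)
open import Relation.Binary.PropositionalEquality
  using (_≢_; refl; sym; trans; cong; cong₂; subst; module ≡-Reasoning)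
open import Relation.Nullary using (yes; no)
open import Relation.Nullary.Decidable using (dec⇒maybe)
open import Tactic.RingSolver using (solve-∀)
open import Tactic.RingSolver.Core.AlmostCommutativeRing using (AlmostCommutativeRing; fromCommutativeRing)

ℚ-ring : AlmostCommutativeRing 0ℓ 0ℓ
ℚ-ring = fromCommutativeRing ℚ.+-*-commutativeRing (dec⇒maybe ∘ (0ℚ ℚ.≟_))

toℚᵘ-ℕ→ℚ : ∀ a → toℚᵘ (ℕ→ℚ a) ℚᵘ.≃ mkℚᵘ (ℤ.+ a) 0
toℚᵘ-ℕ→ℚ a = ℚ.toℚᵘ-fromℚᵘ (mkℚᵘ (ℤ.+ a) 0)

ℕ→ℚ-+ : ∀ a b → ℕ→ℚ (a ℕ.+ b) ≡ ℕ→ℚ a + ℕ→ℚ b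
ℕ→ℚ-+ a b = ℚ.toℚᵘ-injective (begin
  toℚᵘ (ℕ→ℚ (a ℕ.+ b))              ≈⟨ toℚᵘ-ℕ→ℚ (a ℕ.+ b) ⟩
  mkℚᵘ (ℤ.+ (a ℕ.+ b)) 0            ≈⟨ *≡* ℤ-identity ⟩
  mkℚᵘ (ℤ.+ a) 0 ℚᵘ.+ mkℚᵘ (ℤ.+ b) 0 ≈⟨ ℚᵘ.+-cong (toℚᵘ-ℕ→ℚ a) (toℚᵘ-ℕ→ℚ b) ⟨
  toℚᵘ (ℕ→ℚ a) ℚᵘ.+ toℚᵘ (ℕ→ℚ b)    ≈⟨ ℚ.toℚᵘ-homo-+ (ℕ→ℚ a) (ℕ→ℚ b) ⟨
  toℚᵘ (ℕ→ℚ a + ℕ→ℚ b)              ∎)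
  where
  open ℚᵘ.≃-Reasoning
  ℤ-identity : ℤ.+ (a ℕ.+ b) ℤ.* ℤ.+ 1 ≡ (ℤ.+ a ℤ.* ℤ.+ 1 ℤ.+ ℤ.+ b ℤ.* ℤ.+ 1) ℤ.* ℤ.+ 1
  ℤ-identity = trans (ℤ.*-identityʳ _) (trans (ℤ.pos-+ a b) (sym (trans (ℤ.*-identityʳ _)
                 (cong₂ ℤ._+_ (ℤ.*-identityʳ (ℤ.+ a)) (ℤ.*-identityʳ (ℤ.+ b))))))

ℕ→ℚ-* : ∀ a b → ℕ→ℚ (a ℕ.* b) ≡ ℕ→ℚ a * ℕ→ℚ b
ℕ→ℚ-* a b = ℚ.toℚᵘ-injective (begin
  toℚᵘ (ℕ→ℚ (a ℕ.* b))              ≈⟨ toℚᵘ-ℕ→ℚ (a ℕ.* b) ⟩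
  mkℚᵘ (ℤ.+ (a ℕ.* b)) 0            ≈⟨ *≡* ℤ-identity ⟩
  mkℚᵘ (ℤ.+ a) 0 ℚᵘ.* mkℚᵘ (ℤ.+ b) 0 ≈⟨ ℚᵘ.*-cong (toℚᵘ-ℕ→ℚ a) (toℚᵘ-ℕ→ℚ b) ⟨
  toℚᵘ (ℕ→ℚ a) ℚᵘ.* toℚᵘ (ℕ→ℚ b)    ≈⟨ ℚ.toℚᵘ-homo-* (ℕ→ℚ a) (ℕ→ℚ b) ⟨
  toℚᵘ (ℕ→ℚ a * ℕ→ℚ b)              ∎)
  where
  open ℚᵘ.≃-Reasoning
  ℤ-identity : ℤ.+ (a ℕ.* b) ℤ.* ℤ.+ 1 ≡ (ℤ.+ a ℤ.* ℤ.+ b) ℤ.* ℤ.+ 1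
  ℤ-identity = cong (ℤ._* ℤ.+ 1) (ℤ.pos-* a b)

ℕ→ℚ-sumℕ : ∀ n (f : ℕ → ℕ) → ℕ→ℚ (sumℕ n f) ≡ sumℚ n (ℕ→ℚ ∘ f)
ℕ→ℚ-sumℕ zero    f = refl
ℕ→ℚ-sumℕ (suc n) f = trans (ℕ→ℚ-+ (sumℕ n f) (f (suc n))) (cong (_+ ℕ→ℚ (f (suc n))) (ℕ→ℚ-sumℕ n f))

1/-*-ℕ→ℚ : ∀ d .{{_ : NonZero d}} → (ℤ.+ 1 / d) * ℕ→ℚ d ≡ 1ℚ
1/-*-ℕ→ℚ (suc e) = ℚ.toℚᵘ-injective (begin
  toℚᵘ ((ℤ.+ 1 / suc e) * ℕ→ℚ (suc e))          ≈⟨ ℚ.toℚᵘ-homo-* (ℤ.+ 1 / suc e) (ℕ→ℚ (suc e)) ⟩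
  toℚᵘ (ℤ.+ 1 / suc e) ℚᵘ.* toℚᵘ (ℕ→ℚ (suc e))  ≈⟨ ℚᵘ.*-cong (ℚ.toℚᵘ-fromℚᵘ (mkℚᵘ (ℤ.+ 1) e)) (toℚᵘ-ℕ→ℚ (suc e)) ⟩
  mkℚᵘ (ℤ.+ 1) e ℚᵘ.* mkℚᵘ (ℤ.+ suc e) 0        ≈⟨ *≡* ℤ-identity ⟩
  toℚᵘ 1ℚ                                       ∎)
  where
  open ℚᵘ.≃-Reasoning
  ℤ-identity : (ℤ.+ 1 ℤ.* ℤ.+ suc e) ℤ.* ℤ.+ 1 ≡ ℤ.+ 1 ℤ.* ℤ.+ (suc e ℕ.* 1)
  ℤ-identity = trans (ℤ.*-identityʳ _) (cong (λ t → ℤ.+ 1 ℤ.* ℤ.+ t) (sym (*-identityʳ (suc e))))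

inv!-*-! : ∀ n → inv! n * ℕ→ℚ (n !) ≡ 1ℚ
inv!-*-! n = 1/-*-ℕ→ℚ (n !) {{n !≢0}}

inv!-unique : ∀ {x} n → x * ℕ→ℚ (n !) ≡ 1ℚ → x ≡ inv! n
inv!-unique {x} n x*n!≡1 = begin
  x                           ≡⟨ ℚ.*-identityʳ x ⟨
  x * 1ℚ                      ≡⟨ cong (x *_) (trans (ℚ.*-comm (ℕ→ℚ (n !)) (inv! n)) (inv!-*-! n)) ⟨
  x * (ℕ→ℚ (n !) * inv! n)    ≡⟨ ℚ.*-assoc x (ℕ→ℚ (n !)) (inv! n) ⟨
  x * ℕ→ℚ (n !) * inv! n      ≡⟨ cong (_* inv! n) x*n!≡1 ⟩
  1ℚ * inv! n                 ≡⟨ ℚ.*-identityˡ (inv! n) ⟩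
  inv! n                      ∎
  where open ≡-Reasoning

suc-*-inv!-suc : ∀ n → ℕ→ℚ (suc n) * inv! (suc n) ≡ inv! n
suc-*-inv!-suc n = inv!-unique n (begin
  ℕ→ℚ (suc n) * inv! (suc n) * ℕ→ℚ (n !)    ≡⟨ swap (ℕ→ℚ (suc n)) (inv! (suc n)) (ℕ→ℚ (n !)) ⟩
  inv! (suc n) * (ℕ→ℚ (suc n) * ℕ→ℚ (n !))  ≡⟨ cong (inv! (suc n) *_) (ℕ→ℚ-* (suc n) (n !)) ⟨
  inv! (suc n) * ℕ→ℚ (suc n !)              ≡⟨ inv!-*-! (suc n) ⟩
  1ℚ                                        ∎)
  where
  open ≡-Reasoning
  swap : ∀ a b c → a * b * c ≡ b * (a * c)
  swap = solve-∀ ℚ-ring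

sumℚ-cong : ∀ n {f g : ℕ → ℚ} → (∀ i → i ≤ n → f i ≡ g i) → sumℚ n f ≡ sumℚ n g
sumℚ-cong zero    f≗g = f≗g 0 z≤n
sumℚ-cong (suc n) f≗g = cong₂ _+_ (sumℚ-cong n λ i i≤n → f≗g i (m≤n⇒m≤1+n i≤n)) (f≗g (suc n) ≤-refl)

sumℚ-zero : ∀ n {f : ℕ → ℚ} → (∀ i → i ≤ n → f i ≡ 0ℚ) → sumℚ n f ≡ 0ℚ
sumℚ-zero n f≗0 = trans (sumℚ-cong n f≗0) (all-zero n)
  where
  all-zero : ∀ n → sumℚ n (λ _ → 0ℚ) ≡ 0ℚ
  all-zero zero    = refl
  all-zero (suc n) = cong (_+ 0ℚ) (all-zero n)

sumℚ-single : ∀ n {f : ℕ → ℚ} {i} → i ≤ n → (∀ k → k ≤ n → k ≢ i → f k ≡ 0ℚ) → sumℚ n f ≡ f i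
sumℚ-single zero    z≤n   _      = refl
sumℚ-single (suc n) {f} {i} i≤1+n others with m≤n⇒m<n∨m≡n i≤1+n
... | inj₁ (s≤s i≤n) = trans (cong₂ _+_ (sumℚ-single n i≤n λ k k≤n → others k (m≤n⇒m≤1+n k≤n))
                                        (others (suc n) ≤-refl (>⇒≢ (s≤s i≤n))))
                             (ℚ.+-identityʳ (f i))
... | inj₂ refl      = trans (cong (_+ f (suc n)) (sumℚ-zero n λ k k≤n → others k (m≤n⇒m≤1+n k≤n) (<⇒≢ (s≤s k≤n))))
                             (ℚ.+-identityˡ (f (suc n)))

sumℚ-extend : ∀ {n} N {f : ℕ → ℚ} → n ≤ N → (∀ i → n < i → f i ≡ 0ℚ) → sumℚ N f ≡ sumℚ n f
sumℚ-extend zero    z≤n     _      = refl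
sumℚ-extend (suc N) n≤1+N beyond with m≤n⇒m<n∨m≡n n≤1+N
... | inj₁ (s≤s n≤N) = trans (cong₂ _+_ (sumℚ-extend N n≤N beyond) (beyond (suc N) (s≤s n≤N)))
                             (ℚ.+-identityʳ _)
... | inj₂ refl      = refl

sumℚ-+ : ∀ n (f g : ℕ → ℚ) → sumℚ n (λ i → f i + g i) ≡ sumℚ n f + sumℚ n g
sumℚ-+ zero    f g = refl
sumℚ-+ (suc n) f g = trans (cong (_+ (f (suc n) + g (suc n))) (sumℚ-+ n f g))
                           (interchange (sumℚ n f) (sumℚ n g) (f (suc n)) (g (suc n)))
  where
  interchange : ∀ a b c d → (a + b) + (c + d) ≡ (a + c) + (b + d)
  interchange = solve-∀ ℚ-ring

sumℚ-negate : ∀ n (f : ℕ → ℚ) → sumℚ n (λ i → 0ℚ - f i) ≡ 0ℚ - sumℚ n f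
sumℚ-negate zero    f = refl
sumℚ-negate (suc n) f = trans (cong (_+ (0ℚ - f (suc n))) (sumℚ-negate n f)) (negate-+ (sumℚ n f) (f (suc n)))
  where
  negate-+ : ∀ a b → (0ℚ - a) + (0ℚ - b) ≡ 0ℚ - (a + b)
  negate-+ = solve-∀ ℚ-ring

sumℚ-*ˡ : ∀ n c (f : ℕ → ℚ) → c * sumℚ n f ≡ sumℚ n (λ i → c * f i)
sumℚ-*ˡ zero    c f = refl
sumℚ-*ˡ (suc n) c f = trans (ℚ.*-distribˡ-+ c (sumℚ n f) (f (suc n))) (cong (_+ (c * f (suc n))) (sumℚ-*ˡ n c f))

sumℚ-*ʳ : ∀ n c (f : ℕ → ℚ) → sumℚ n f * c ≡ sumℚ n (λ i → f i * c)
sumℚ-*ʳ zero    c f = refl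
sumℚ-*ʳ (suc n) c f = trans (ℚ.*-distribʳ-+ c (sumℚ n f) (f (suc n))) (cong (_+ (f (suc n) * c)) (sumℚ-*ʳ n c f))

sumℚ-head : ∀ n (f : ℕ → ℚ) → sumℚ (suc n) f ≡ f 0 + sumℚ n (f ∘ suc)
sumℚ-head zero    f = refl
sumℚ-head (suc n) f = trans (cong (_+ f (suc (suc n))) (sumℚ-head n f)) (ℚ.+-assoc (f 0) (sumℚ n (f ∘ suc)) _)

sumℚ-swap : ∀ n m (f : ℕ → ℕ → ℚ) → sumℚ n (λ i → sumℚ m (f i)) ≡ sumℚ m (λ j → sumℚ n (λ i → f i j))
sumℚ-swap zero    m f = refl
sumℚ-swap (suc n) m f = trans (cong (_+ sumℚ m (f (suc n))) (sumℚ-swap n m f)) (sym (sumℚ-+ m _ _))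

sumℚ-*-sumℚ : ∀ m n (f g : ℕ → ℚ) → sumℚ m f * sumℚ n g ≡ sumℚ m (λ a → sumℚ n (λ b → f a * g b))
sumℚ-*-sumℚ m n f g = trans (sumℚ-*ʳ m (sumℚ n g) f) (sumℚ-cong m λ a _ → sumℚ-*ˡ n (f a) g)

sumℚ-triangle : ∀ n (F : ℕ → ℕ → ℚ) →
  sumℚ n (λ k → sumℚ k (λ a → F a (k ∸ a))) ≡ sumℚ n (λ a → sumℚ (n ∸ a) (F a))
sumℚ-triangle zero    F = refl
sumℚ-triangle (suc n) F = begin
  sumℚ n (λ k → sumℚ k (λ a → F a (k ∸ a))) + sumℚ (suc n) (λ a → F a (suc n ∸ a))
    ≡⟨ cong (_+ sumℚ (suc n) (λ a → F a (suc n ∸ a))) (sumℚ-triangle n F) ⟩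
  sumℚ n (λ a → sumℚ (n ∸ a) (F a)) + (sumℚ n (λ a → F a (suc n ∸ a)) + F (suc n) (n ∸ n))
    ≡⟨ ℚ.+-assoc (sumℚ n (λ a → sumℚ (n ∸ a) (F a))) (sumℚ n (λ a → F a (suc n ∸ a))) _ ⟨
  (sumℚ n (λ a → sumℚ (n ∸ a) (F a)) + sumℚ n (λ a → F a (suc n ∸ a))) + F (suc n) (n ∸ n)
    ≡⟨ cong (_+ F (suc n) (n ∸ n)) (sumℚ-+ n _ _) ⟨
  sumℚ n (λ a → sumℚ (n ∸ a) (F a) + F a (suc n ∸ a)) + F (suc n) (n ∸ n)
    ≡⟨ cong (_+ F (suc n) (n ∸ n)) (sumℚ-cong n λ a a≤n →
         cong (λ t → sumℚ (n ∸ a) (F a) + F a t) (+-∸-assoc 1 a≤n)) ⟩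
  sumℚ n (λ a → sumℚ (suc (n ∸ a)) (F a)) + F (suc n) (n ∸ n)
    ≡⟨ cong (_+ F (suc n) (n ∸ n)) (sumℚ-cong n λ a a≤n →
         cong (λ t → sumℚ t (F a)) (+-∸-assoc 1 a≤n)) ⟨
  sumℚ n (λ a → sumℚ (suc n ∸ a) (F a)) + F (suc n) (n ∸ n)
    ≡⟨ cong (sumℚ n (λ a → sumℚ (suc n ∸ a) (F a)) +_) (sumℚ-n∸n n (F (suc n))) ⟨
  sumℚ n (λ a → sumℚ (suc n ∸ a) (F a)) + sumℚ (n ∸ n) (F (suc n))
    ∎
  where
  open ≡-Reasoning
  sumℚ-n∸n : ∀ n f → sumℚ (n ∸ n) f ≡ f (n ∸ n)
  sumℚ-n∸n zero    f = refl
  sumℚ-n∸n (suc n) f = sumℚ-n∸n n f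

-- Formal power series

one-pos : ∀ {m} → 0 < m → one m ≡ 0ℚ
one-pos (s≤s z≤n) = refl

⊛-congˡ : ∀ {f f′ : FPS} (g : FPS) → (∀ i → f i ≡ f′ i) → ∀ n → (f ⊛ g) n ≡ (f′ ⊛ g) n
⊛-congˡ g f≗f′ n = sumℚ-cong n λ i _ → cong (_* g (n ∸ i)) (f≗f′ i)

⊛-congʳ : ∀ (f : FPS) {g g′ : FPS} → (∀ i → g i ≡ g′ i) → ∀ n → (f ⊛ g) n ≡ (f ⊛ g′) n
⊛-congʳ f g≗g′ n = sumℚ-cong n λ i _ → cong (f i *_) (g≗g′ (n ∸ i))

⊛-identityˡ : ∀ (f : FPS) n → (one ⊛ f) n ≡ f n
⊛-identityˡ f n = trans (sumℚ-single n z≤n others) (ℚ.*-identityˡ (f n))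
  where
  others : ∀ k → k ≤ n → k ≢ 0 → one k * f (n ∸ k) ≡ 0ℚ
  others zero    _ k≢0 = ⊥-elim (k≢0 refl)
  others (suc k) _ _   = ℚ.*-zeroˡ (f (n ∸ suc k))

⊛-identityʳ : ∀ (f : FPS) n → (f ⊛ one) n ≡ f n
⊛-identityʳ f n = begin
  sumℚ n (λ i → f i * one (n ∸ i))   ≡⟨ sumℚ-single n ≤-refl others ⟩
  f n * one (n ∸ n)                  ≡⟨ cong (λ t → f n * one t) (n∸n≡0 n) ⟩
  f n * 1ℚ                           ≡⟨ ℚ.*-identityʳ (f n) ⟩
  f n                                ∎
  where
  open ≡-Reasoning
  others : ∀ k → k ≤ n → k ≢ n → f k * one (n ∸ k) ≡ 0ℚ
  others k k≤n k≢n = trans (cong (f k *_) (one-pos (m<n⇒0<n∸m (≤∧≢⇒< k≤n k≢n)))) (ℚ.*-zeroʳ (f k))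

⊛-distribʳ-+ : ∀ (f g h : FPS) n → ((λ i → f i + g i) ⊛ h) n ≡ (f ⊛ h) n + (g ⊛ h) n
⊛-distribʳ-+ f g h n = trans (sumℚ-cong n λ i _ → ℚ.*-distribʳ-+ (h (n ∸ i)) (f i) (g i)) (sumℚ-+ n _ _)

⊛-distribˡ-+ : ∀ (f g h : FPS) n → (f ⊛ (λ i → g i + h i)) n ≡ (f ⊛ g) n + (f ⊛ h) n
⊛-distribˡ-+ f g h n = trans (sumℚ-cong n λ i _ → ℚ.*-distribˡ-+ (f i) (g (n ∸ i)) (h (n ∸ i))) (sumℚ-+ n _ _)

⊛-*ʳ : ∀ (f g : FPS) c n → (f ⊛ (λ i → c * g i)) n ≡ c * (f ⊛ g) n
⊛-*ʳ f g c n = trans (sumℚ-cong n λ i _ → swap (f i) c (g (n ∸ i))) (sym (sumℚ-*ˡ n c _))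
  where
  swap : ∀ a b c → a * (b * c) ≡ b * (a * c)
  swap = solve-∀ ℚ-ring

⊛-negateʳ : ∀ (f g : FPS) n → (f ⊛ (λ i → 0ℚ - g i)) n ≡ 0ℚ - (f ⊛ g) n
⊛-negateʳ f g n = trans (sumℚ-cong n λ i _ → *-negate (f i) (g (n ∸ i))) (sumℚ-negate n _)
  where
  *-negate : ∀ a b → a * (0ℚ - b) ≡ 0ℚ - a * b
  *-negate = solve-∀ ℚ-ring

⊛-assoc : ∀ (f g h : FPS) n → ((f ⊛ g) ⊛ h) n ≡ (f ⊛ (g ⊛ h)) n
⊛-assoc f g h n = begin
  sumℚ n (λ k → sumℚ k (λ a → f a * g (k ∸ a)) * h (n ∸ k))
    ≡⟨ sumℚ-cong n (λ k _ → sumℚ-*ʳ k (h (n ∸ k)) (λ a → f a * g (k ∸ a))) ⟩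
  sumℚ n (λ k → sumℚ k (λ a → f a * g (k ∸ a) * h (n ∸ k)))
    ≡⟨ sumℚ-cong n (λ k _ → sumℚ-cong k λ a a≤k → cong (λ t → f a * g (k ∸ a) * h (n ∸ t)) (m+[n∸m]≡n a≤k)) ⟨
  sumℚ n (λ k → sumℚ k (λ a → F a (k ∸ a)))
    ≡⟨ sumℚ-triangle n F ⟩
  sumℚ n (λ a → sumℚ (n ∸ a) (F a))
    ≡⟨ sumℚ-cong n (λ a _ → sumℚ-cong (n ∸ a) λ b _ →
         trans (cong (λ t → f a * g b * h t) (sym (∸-+-assoc n a b))) (ℚ.*-assoc (f a) (g b) _)) ⟩
  sumℚ n (λ a → sumℚ (n ∸ a) (λ b → f a * (g b * h (n ∸ a ∸ b))))
    ≡⟨ sumℚ-cong n (λ a _ → sumℚ-*ˡ (n ∸ a) (f a) (λ b → g b * h (n ∸ a ∸ b))) ⟨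
  sumℚ n (λ a → f a * sumℚ (n ∸ a) (λ b → g b * h (n ∸ a ∸ b)))
    ∎
  where
  open ≡-Reasoning
  F : ℕ → ℕ → ℚ
  F a b = f a * g b * h (n ∸ (a ℕ.+ b))

pow-+ : ∀ (g : FPS) a b n → pow g (a ℕ.+ b) n ≡ (pow g a ⊛ pow g b) n
pow-+ g zero    b n = sym (⊛-identityˡ (pow g b) n)
pow-+ g (suc a) b n = trans (⊛-congʳ g (pow-+ g a b) n) (sym (⊛-assoc g (pow g a) (pow g b) n))

pow-suc-⊛ : ∀ (g : FPS) k n → pow g (suc k) n ≡ (pow g k ⊛ g) n
pow-suc-⊛ g k n = begin
  pow g (suc k) n        ≡⟨ cong (λ t → pow g t n) (+-comm 1 k) ⟩
  pow g (k ℕ.+ 1) n      ≡⟨ pow-+ g k 1 n ⟩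
  (pow g k ⊛ pow g 1) n  ≡⟨ ⊛-congʳ (pow g k) (⊛-identityʳ g) n ⟩
  (pow g k ⊛ g) n        ∎
  where open ≡-Reasoning

pow-vanishes : ∀ {g : FPS} → g 0 ≡ 0ℚ → ∀ k {n} → n < k → pow g k n ≡ 0ℚ
pow-vanishes {g} g₀≡0 (suc k) {n} (s≤s n≤k) = sumℚ-zero n term
  where
  term : ∀ i → i ≤ n → g i * pow g k (n ∸ i) ≡ 0ℚ
  term zero    _     = trans (cong (_* pow g k n) g₀≡0) (ℚ.*-zeroˡ (pow g k n))
  term (suc i) 1+i≤n = trans (cong (g (suc i) *_) (pow-vanishes g₀≡0 k (<-≤-trans (∸-monoʳ-< (s≤s z≤n) 1+i≤n) n≤k)))
                             (ℚ.*-zeroʳ (g (suc i)))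

-- Composition

compose-one : ∀ (g : FPS) n → compose one g n ≡ one n
compose-one g n = trans (sumℚ-single n z≤n others) (ℚ.*-identityˡ (one n))
  where
  others : ∀ k → k ≤ n → k ≢ 0 → one k * pow g k n ≡ 0ℚ
  others zero    _ k≢0 = ⊥-elim (k≢0 refl)
  others (suc k) _ _   = ℚ.*-zeroˡ (pow g (suc k) n)

module _ {g : FPS} (g₀≡0 : g 0 ≡ 0ℚ) where

  private
    coeff-vanishes : ∀ (c : FPS) {a m} → m < a → c a * pow g a m ≡ 0ℚ
    coeff-vanishes c {a} m<a = trans (cong (c a *_) (pow-vanishes g₀≡0 a m<a)) (ℚ.*-zeroʳ (c a))

  compose-⊛-expand : ∀ (f h : FPS) n →
    compose (f ⊛ h) g n ≡ sumℚ n (λ a → sumℚ n (λ b → f a * h b * pow g (a ℕ.+ b) n))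
  compose-⊛-expand f h n = begin
    sumℚ n (λ k → sumℚ k (λ a → f a * h (k ∸ a)) * pow g k n)
      ≡⟨ sumℚ-cong n (λ k _ → sumℚ-*ʳ k (pow g k n) (λ a → f a * h (k ∸ a))) ⟩
    sumℚ n (λ k → sumℚ k (λ a → f a * h (k ∸ a) * pow g k n))
      ≡⟨ sumℚ-cong n (λ k _ → sumℚ-cong k λ a a≤k → cong (λ t → f a * h (k ∸ a) * pow g t n) (m+[n∸m]≡n a≤k)) ⟨
    sumℚ n (λ k → sumℚ k (λ a → F a (k ∸ a)))
      ≡⟨ sumℚ-triangle n F ⟩
    sumℚ n (λ a → sumℚ (n ∸ a) (F a))
      ≡⟨ sumℚ-cong n (λ a _ → sumℚ-extend n (m∸n≤m n a) λ b n∸a<b →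
           coeff-vanishes (λ _ → f a * h b) (≤-<-trans (m≤n+m∸n n a) (+-monoʳ-< a n∸a<b))) ⟨
    sumℚ n (λ a → sumℚ n (F a))
      ∎
    where
    open ≡-Reasoning
    F : ℕ → ℕ → ℚ
    F a b = f a * h b * pow g (a ℕ.+ b) n

  ⊛-compose-expand : ∀ (f h : FPS) n →
    (compose f g ⊛ compose h g) n ≡ sumℚ n (λ a → sumℚ n (λ b → f a * h b * (pow g a ⊛ pow g b) n))
  ⊛-compose-expand f h n = begin
    sumℚ n (λ i → sumℚ i (λ a → f a * pow g a i) * sumℚ (n ∸ i) (λ b → h b * pow g b (n ∸ i)))
      ≡⟨ sumℚ-cong n (λ i i≤n → cong₂ _*_
           (sumℚ-extend n i≤n (λ a i<a → coeff-vanishes f i<a))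
           (sumℚ-extend n (m∸n≤m n i) (λ b n∸i<b → coeff-vanishes h n∸i<b))) ⟨
    sumℚ n (λ i → sumℚ n (λ a → f a * pow g a i) * sumℚ n (λ b → h b * pow g b (n ∸ i)))
      ≡⟨ sumℚ-cong n (λ i _ → sumℚ-*-sumℚ n n _ _) ⟩
    sumℚ n (λ i → sumℚ n (λ a → sumℚ n (λ b → (f a * pow g a i) * (h b * pow g b (n ∸ i)))))
      ≡⟨ sumℚ-cong n (λ i _ → sumℚ-cong n λ a _ → sumℚ-cong n λ b _ → interchange (f a) (pow g a i) (h b) _) ⟩
    sumℚ n (λ i → sumℚ n (λ a → sumℚ n (λ b → T a b i)))
      ≡⟨ sumℚ-swap n n _ ⟩
    sumℚ n (λ a → sumℚ n (λ i → sumℚ n (λ b → T a b i)))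
      ≡⟨ sumℚ-cong n (λ a _ → sumℚ-swap n n _) ⟩
    sumℚ n (λ a → sumℚ n (λ b → sumℚ n (λ i → T a b i)))
      ≡⟨ sumℚ-cong n (λ a _ → sumℚ-cong n λ b _ → sumℚ-*ˡ n (f a * h b) _) ⟨
    sumℚ n (λ a → sumℚ n (λ b → f a * h b * (pow g a ⊛ pow g b) n))
      ∎
    where
    open ≡-Reasoning
    T : ℕ → ℕ → ℕ → ℚ
    T a b i = f a * h b * (pow g a i * pow g b (n ∸ i))
    interchange : ∀ w x y z → (w * x) * (y * z) ≡ (w * y) * (x * z)
    interchange = solve-∀ ℚ-ring

  compose-⊛ : ∀ (f h : FPS) n → compose (f ⊛ h) g n ≡ (compose f g ⊛ compose h g) n
  compose-⊛ f h n = begin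
    compose (f ⊛ h) g n
      ≡⟨ compose-⊛-expand f h n ⟩
    sumℚ n (λ a → sumℚ n (λ b → f a * h b * pow g (a ℕ.+ b) n))
      ≡⟨ sumℚ-cong n (λ a _ → sumℚ-cong n λ b _ → cong (f a * h b *_) (pow-+ g a b n)) ⟩
    sumℚ n (λ a → sumℚ n (λ b → f a * h b * (pow g a ⊛ pow g b) n))
      ≡⟨ ⊛-compose-expand f h n ⟨
    (compose f g ⊛ compose h g) n
      ∎
    where open ≡-Reasoning

  pow-compose : ∀ (f : FPS) m n → pow (compose f g) m n ≡ compose (pow f m) g n
  pow-compose f zero    n = sym (compose-one g n)
  pow-compose f (suc m) n = trans (⊛-congʳ (compose f g) (pow-compose f m) n) (sym (compose-⊛ f (pow f m) n))

-- The exponential generating function of the Stirling numbers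

derivative : FPS → FPS
derivative f n = ℕ→ℚ (suc n) * f (suc n)

derivative-⊛ : ∀ (f g : FPS) n → derivative (f ⊛ g) n ≡ (derivative f ⊛ g) n + (f ⊛ derivative g) n
derivative-⊛ f g n = begin
  ℕ→ℚ (suc n) * sumℚ (suc n) (λ i → f i * g (suc n ∸ i))
    ≡⟨ sumℚ-*ˡ (suc n) (ℕ→ℚ (suc n)) _ ⟩
  sumℚ (suc n) (λ i → ℕ→ℚ (suc n) * (f i * g (suc n ∸ i)))
    ≡⟨ sumℚ-cong (suc n) (λ i i≤1+n → split-weight i≤1+n (f i * g (suc n ∸ i))) ⟩
  sumℚ (suc n) (λ i → ℕ→ℚ i * (f i * g (suc n ∸ i)) + ℕ→ℚ (suc n ∸ i) * (f i * g (suc n ∸ i)))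
    ≡⟨ sumℚ-+ (suc n) _ _ ⟩
  sumℚ (suc n) (λ i → ℕ→ℚ i * (f i * g (suc n ∸ i))) + sumℚ (suc n) (λ i → ℕ→ℚ (suc n ∸ i) * (f i * g (suc n ∸ i)))
    ≡⟨ cong₂ _+_ left-weighted right-weighted ⟩
  (derivative f ⊛ g) n + (f ⊛ derivative g) n
    ∎
  where
  open ≡-Reasoning
  split-weight : ∀ {i} → i ≤ suc n → ∀ x → ℕ→ℚ (suc n) * x ≡ ℕ→ℚ i * x + ℕ→ℚ (suc n ∸ i) * x
  split-weight {i} i≤1+n x = begin
    ℕ→ℚ (suc n) * x                           ≡⟨ cong (λ t → ℕ→ℚ t * x) (m+[n∸m]≡n i≤1+n) ⟨
    ℕ→ℚ (i ℕ.+ (suc n ∸ i)) * x               ≡⟨ cong (_* x) (ℕ→ℚ-+ i (suc n ∸ i)) ⟩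
    (ℕ→ℚ i + ℕ→ℚ (suc n ∸ i)) * x             ≡⟨ ℚ.*-distribʳ-+ x (ℕ→ℚ i) (ℕ→ℚ (suc n ∸ i)) ⟩
    ℕ→ℚ i * x + ℕ→ℚ (suc n ∸ i) * x           ∎
  left-weighted : sumℚ (suc n) (λ i → ℕ→ℚ i * (f i * g (suc n ∸ i))) ≡ (derivative f ⊛ g) n
  left-weighted = begin
    sumℚ (suc n) (λ i → ℕ→ℚ i * (f i * g (suc n ∸ i)))
      ≡⟨ sumℚ-head n _ ⟩
    0ℚ * (f 0 * g (suc n)) + sumℚ n (λ i → ℕ→ℚ (suc i) * (f (suc i) * g (n ∸ i)))
      ≡⟨ cong (_+ sumℚ n (λ i → ℕ→ℚ (suc i) * (f (suc i) * g (n ∸ i)))) (ℚ.*-zeroˡ (f 0 * g (suc n))) ⟩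
    0ℚ + sumℚ n (λ i → ℕ→ℚ (suc i) * (f (suc i) * g (n ∸ i)))
      ≡⟨ ℚ.+-identityˡ _ ⟩
    sumℚ n (λ i → ℕ→ℚ (suc i) * (f (suc i) * g (n ∸ i)))
      ≡⟨ sumℚ-cong n (λ i _ → ℚ.*-assoc (ℕ→ℚ (suc i)) (f (suc i)) (g (n ∸ i))) ⟨
    (derivative f ⊛ g) n
      ∎
  right-weighted : sumℚ (suc n) (λ i → ℕ→ℚ (suc n ∸ i) * (f i * g (suc n ∸ i))) ≡ (f ⊛ derivative g) n
  right-weighted = begin
    sumℚ n (λ i → ℕ→ℚ (suc n ∸ i) * (f i * g (suc n ∸ i))) + ℕ→ℚ (n ∸ n) * (f (suc n) * g (n ∸ n))
      ≡⟨ cong (λ t → sumℚ n (λ i → ℕ→ℚ (suc n ∸ i) * (f i * g (suc n ∸ i))) + ℕ→ℚ t * (f (suc n) * g t)) (n∸n≡0 n) ⟩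
    sumℚ n (λ i → ℕ→ℚ (suc n ∸ i) * (f i * g (suc n ∸ i))) + 0ℚ * (f (suc n) * g 0)
      ≡⟨ cong (sumℚ n (λ i → ℕ→ℚ (suc n ∸ i) * (f i * g (suc n ∸ i))) +_) (ℚ.*-zeroˡ (f (suc n) * g 0)) ⟩
    sumℚ n (λ i → ℕ→ℚ (suc n ∸ i) * (f i * g (suc n ∸ i))) + 0ℚ
      ≡⟨ ℚ.+-identityʳ _ ⟩
    sumℚ n (λ i → ℕ→ℚ (suc n ∸ i) * (f i * g (suc n ∸ i)))
      ≡⟨ sumℚ-cong n (λ i i≤n → trans (cong (λ t → ℕ→ℚ t * (f i * g t)) (+-∸-assoc 1 i≤n))
                                      (swap (ℕ→ℚ (suc (n ∸ i))) (f i) _)) ⟩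
    (f ⊛ derivative g) n
      ∎
    where
    swap : ∀ a b c → a * (b * c) ≡ b * (a * c)
    swap = solve-∀ ℚ-ring

derivative-expm1 : ∀ n → derivative expm1 n ≡ expm1 n + one n
derivative-expm1 zero    = refl
derivative-expm1 (suc n) = trans (suc-*-inv!-suc (suc n)) (sym (ℚ.+-identityʳ (inv! (suc n))))

derivative-pow-expm1 : ∀ k n →
  derivative (pow expm1 (suc k)) n ≡ ℕ→ℚ (suc k) * (pow expm1 (suc k) n + pow expm1 k n)
expm1-⊛-derivative-pow : ∀ k n →
  (expm1 ⊛ derivative (pow expm1 k)) n ≡ ℕ→ℚ k * (pow expm1 (suc k) n + pow expm1 k n)

derivative-pow-expm1 k n = begin
  derivative (expm1 ⊛ pow expm1 k) n
    ≡⟨ derivative-⊛ expm1 (pow expm1 k) n ⟩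
  (derivative expm1 ⊛ pow expm1 k) n + (expm1 ⊛ derivative (pow expm1 k)) n
    ≡⟨ cong₂ _+_ product-rule-left (expm1-⊛-derivative-pow k n) ⟩
  x + ℕ→ℚ k * x
    ≡⟨ +-*-1+ x (ℕ→ℚ k) ⟩
  (1ℚ + ℕ→ℚ k) * x
    ≡⟨ cong (_* x) (ℕ→ℚ-+ 1 k) ⟨
  ℕ→ℚ (suc k) * x
    ∎
  where
  open ≡-Reasoning
  x : ℚ
  x = pow expm1 (suc k) n + pow expm1 k n
  product-rule-left : (derivative expm1 ⊛ pow expm1 k) n ≡ x
  product-rule-left = begin
    (derivative expm1 ⊛ pow expm1 k) n               ≡⟨ ⊛-congˡ (pow expm1 k) derivative-expm1 n ⟩
    ((λ i → expm1 i + one i) ⊛ pow expm1 k) n        ≡⟨ ⊛-distribʳ-+ expm1 one (pow expm1 k) n ⟩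
    pow expm1 (suc k) n + (one ⊛ pow expm1 k) n      ≡⟨ cong (pow expm1 (suc k) n +_) (⊛-identityˡ (pow expm1 k) n) ⟩
    x                                                ∎
  +-*-1+ : ∀ a c → a + c * a ≡ (1ℚ + c) * a
  +-*-1+ = solve-∀ ℚ-ring

expm1-⊛-derivative-pow zero    n = begin
  (expm1 ⊛ derivative one) n
    ≡⟨ sumℚ-zero n (λ i _ → trans (cong (expm1 i *_) (ℚ.*-zeroʳ (ℕ→ℚ (suc (n ∸ i))))) (ℚ.*-zeroʳ (expm1 i))) ⟩
  0ℚ
    ≡⟨ ℚ.*-zeroˡ (pow expm1 1 n + one n) ⟨
  0ℚ * (pow expm1 1 n + one n)
    ∎
  where open ≡-Reasoning
expm1-⊛-derivative-pow (suc k) n = begin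
  (expm1 ⊛ derivative (pow expm1 (suc k))) n
    ≡⟨ ⊛-congʳ expm1 (derivative-pow-expm1 k) n ⟩
  (expm1 ⊛ (λ i → ℕ→ℚ (suc k) * (pow expm1 (suc k) i + pow expm1 k i))) n
    ≡⟨ ⊛-*ʳ expm1 (λ i → pow expm1 (suc k) i + pow expm1 k i) (ℕ→ℚ (suc k)) n ⟩
  ℕ→ℚ (suc k) * (expm1 ⊛ (λ i → pow expm1 (suc k) i + pow expm1 k i)) n
    ≡⟨ cong (ℕ→ℚ (suc k) *_) (⊛-distribˡ-+ expm1 (pow expm1 (suc k)) (pow expm1 k) n) ⟩
  ℕ→ℚ (suc k) * (pow expm1 (suc (suc k)) n + pow expm1 (suc k) n)
    ∎
  where open ≡-Reasoning

ℕ→ℚ-S-suc : ∀ n k → ℕ→ℚ (S (suc n) (suc k)) ≡ ℕ→ℚ (suc k) * ℕ→ℚ (S n (suc k)) + ℕ→ℚ (S n k)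
ℕ→ℚ-S-suc n k = trans (ℕ→ℚ-+ (suc k ℕ.* S n (suc k)) (S n k)) (cong (_+ ℕ→ℚ (S n k)) (ℕ→ℚ-* (suc k) (S n (suc k))))

!-*-pow-expm1 : ∀ n k → ℕ→ℚ (n !) * pow expm1 k n ≡ ℕ→ℚ (S n k) * ℕ→ℚ (k !)
!-*-pow-expm1 zero    zero    = refl
!-*-pow-expm1 zero    (suc k) = trans (cong (ℕ→ℚ 1 *_) (ℚ.*-zeroˡ (pow expm1 k 0))) (sym (ℚ.*-zeroˡ (ℕ→ℚ (suc k !))))
!-*-pow-expm1 (suc n) zero    = ℚ.*-zeroʳ (ℕ→ℚ (suc n !))
!-*-pow-expm1 (suc n) (suc k) = begin
  ℕ→ℚ (suc n !) * pow expm1 (suc k) (suc n)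
    ≡⟨ cong (_* pow expm1 (suc k) (suc n)) (ℕ→ℚ-* (suc n) (n !)) ⟩
  ℕ→ℚ (suc n) * ℕ→ℚ (n !) * pow expm1 (suc k) (suc n)
    ≡⟨ swap (ℕ→ℚ (suc n)) (ℕ→ℚ (n !)) _ ⟩
  ℕ→ℚ (n !) * derivative (pow expm1 (suc k)) n
    ≡⟨ cong (ℕ→ℚ (n !) *_) (derivative-pow-expm1 k n) ⟩
  ℕ→ℚ (n !) * (K * (pow expm1 (suc k) n + pow expm1 k n))
    ≡⟨ distrib (ℕ→ℚ (n !)) K (pow expm1 (suc k) n) (pow expm1 k n) ⟩
  K * (ℕ→ℚ (n !) * pow expm1 (suc k) n + ℕ→ℚ (n !) * pow expm1 k n)
    ≡⟨ cong₂ (λ a b → K * (a + b)) (!-*-pow-expm1 n (suc k)) (!-*-pow-expm1 n k) ⟩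
  K * (ℕ→ℚ (S n (suc k)) * ℕ→ℚ (suc k !) + ℕ→ℚ (S n k) * ℕ→ℚ (k !))
    ≡⟨ cong (λ t → K * (ℕ→ℚ (S n (suc k)) * t + ℕ→ℚ (S n k) * ℕ→ℚ (k !))) (ℕ→ℚ-* (suc k) (k !)) ⟩
  K * (ℕ→ℚ (S n (suc k)) * (K * ℕ→ℚ (k !)) + ℕ→ℚ (S n k) * ℕ→ℚ (k !))
    ≡⟨ factor K (ℕ→ℚ (S n (suc k))) (ℕ→ℚ (S n k)) (ℕ→ℚ (k !)) ⟩
  (K * ℕ→ℚ (S n (suc k)) + ℕ→ℚ (S n k)) * (K * ℕ→ℚ (k !))
    ≡⟨ cong₂ _*_ (ℕ→ℚ-S-suc n k) (ℕ→ℚ-* (suc k) (k !)) ⟨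
  ℕ→ℚ (S (suc n) (suc k)) * ℕ→ℚ (suc k !)
    ∎
  where
  open ≡-Reasoning
  K : ℚ
  K = ℕ→ℚ (suc k)
  swap : ∀ a b c → a * b * c ≡ b * (a * c)
  swap = solve-∀ ℚ-ring
  distrib : ∀ a c x y → a * (c * (x + y)) ≡ c * (a * x + a * y)
  distrib = solve-∀ ℚ-ring
  factor : ∀ c a b f → c * (a * (c * f) + b * f) ≡ (c * a + b) * (c * f)
  factor = solve-∀ ℚ-ring

pow-expm1 : ∀ k n → pow expm1 k n ≡ ℕ→ℚ (S n k) * ℕ→ℚ (k !) * inv! n
pow-expm1 k n = begin
  pow expm1 k n                                 ≡⟨ ℚ.*-identityˡ (pow expm1 k n) ⟨
  1ℚ * pow expm1 k n                            ≡⟨ cong (_* pow expm1 k n) (inv!-*-! n) ⟨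
  inv! n * ℕ→ℚ (n !) * pow expm1 k n            ≡⟨ ℚ.*-assoc (inv! n) (ℕ→ℚ (n !)) (pow expm1 k n) ⟩
  inv! n * (ℕ→ℚ (n !) * pow expm1 k n)          ≡⟨ cong (inv! n *_) (!-*-pow-expm1 n k) ⟩
  inv! n * (ℕ→ℚ (S n k) * ℕ→ℚ (k !))            ≡⟨ ℚ.*-comm (inv! n) _ ⟩
  ℕ→ℚ (S n k) * ℕ→ℚ (k !) * inv! n              ∎
  where open ≡-Reasoning

-- Powers of the Stirling matrix

Matrix : Set
Matrix = ℕ → ℕ → ℚ

-- Truncating at k = n is harmless as long as the left factor is lower triangular.
_·_ : Matrix → Matrix → Matrix
(A · B) n m = sumℚ n (λ k → A n k * B k m)

LowerTriangular : Matrix → Set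
LowerTriangular A = ∀ {k j} → k < j → A k j ≡ 0ℚ

·-assoc : ∀ (A B C : Matrix) → LowerTriangular B → ∀ n m → (A · (B · C)) n m ≡ ((A · B) · C) n m
·-assoc A B C B-lower n m = begin
  sumℚ n (λ k → A n k * sumℚ k (λ j → B k j * C j m))
    ≡⟨ sumℚ-cong n (λ k _ → sumℚ-*ˡ k (A n k) (λ j → B k j * C j m)) ⟩
  sumℚ n (λ k → sumℚ k (λ j → A n k * (B k j * C j m)))
    ≡⟨ sumℚ-cong n (λ k k≤n → sumℚ-extend n k≤n λ j k<j →
         trans (cong (λ t → A n k * (t * C j m)) (B-lower k<j))
               (trans (cong (A n k *_) (ℚ.*-zeroˡ (C j m))) (ℚ.*-zeroʳ (A n k)))) ⟨
  sumℚ n (λ k → sumℚ n (λ j → A n k * (B k j * C j m)))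
    ≡⟨ sumℚ-swap n n _ ⟩
  sumℚ n (λ j → sumℚ n (λ k → A n k * (B k j * C j m)))
    ≡⟨ sumℚ-cong n (λ j _ → sumℚ-cong n λ k _ → ℚ.*-assoc (A n k) (B k j) (C j m)) ⟨
  sumℚ n (λ j → sumℚ n (λ k → A n k * B k j * C j m))
    ≡⟨ sumℚ-cong n (λ j _ → sumℚ-*ʳ n (C j m) (λ k → A n k * B k j)) ⟨
  sumℚ n (λ j → (A · B) n j * C j m)
    ∎
  where open ≡-Reasoning

𝒮 : Matrix
𝒮 n m = ℕ→ℚ (S n m)

𝒮^ : ℕ → Matrix
𝒮^ p n m = ℕ→ℚ (Spow p n m)

S-vanishes : ∀ {n m} → n < m → S n m ≡ 0
S-vanishes {zero}  {suc m} _         = refl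
S-vanishes {suc n} {suc m} (s≤s n<m) = begin
  suc m ℕ.* S n (suc m) ℕ.+ S n m   ≡⟨ cong₂ (λ x y → suc m ℕ.* x ℕ.+ y) (S-vanishes (m<n⇒m<1+n n<m)) (S-vanishes n<m) ⟩
  suc m ℕ.* 0 ℕ.+ 0                 ≡⟨ +-identityʳ (suc m ℕ.* 0) ⟩
  suc m ℕ.* 0                       ≡⟨ *-zeroʳ (suc m) ⟩
  0                                 ∎
  where open ≡-Reasoning

Spow-zero-≡ : ∀ n → Spow 0 n n ≡ 1
Spow-zero-≡ n with n ℕ.≟ n
... | yes _   = refl
... | no n≢n  = ⊥-elim (n≢n refl)

Spow-zero-≢ : ∀ {n m} → n ≢ m → Spow 0 n m ≡ 0
Spow-zero-≢ {n} {m} n≢m with n ℕ.≟ m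
... | yes n≡m = ⊥-elim (n≢m n≡m)
... | no _    = refl

𝒮^-suc : ∀ p n m → 𝒮^ (suc p) n m ≡ (𝒮^ p · 𝒮) n m
𝒮^-suc p n m = trans (ℕ→ℚ-sumℕ n (λ k → Spow p n k ℕ.* S k m)) (sumℚ-cong n λ k _ → ℕ→ℚ-* (Spow p n k) (S k m))

𝒮-lowerTriangular : LowerTriangular 𝒮
𝒮-lowerTriangular k<j = cong ℕ→ℚ (S-vanishes k<j)

𝒮^-lowerTriangular : ∀ p → LowerTriangular (𝒮^ p)
𝒮^-lowerTriangular zero    k<j = cong ℕ→ℚ (Spow-zero-≢ (<⇒≢ k<j))
𝒮^-lowerTriangular (suc p) {k} {j} k<j = trans (𝒮^-suc p k j) (sumℚ-zero k λ i i≤k →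
  trans (cong (𝒮^ p k i *_) (𝒮-lowerTriangular (≤-<-trans i≤k k<j))) (ℚ.*-zeroʳ (𝒮^ p k i)))

·-identityˡ : ∀ (A : Matrix) n m → (𝒮^ 0 · A) n m ≡ A n m
·-identityˡ A n m = begin
  sumℚ n (λ k → 𝒮^ 0 n k * A k m)   ≡⟨ sumℚ-single n ≤-refl others ⟩
  𝒮^ 0 n n * A n m                  ≡⟨ cong (λ t → ℕ→ℚ t * A n m) (Spow-zero-≡ n) ⟩
  1ℚ * A n m                        ≡⟨ ℚ.*-identityˡ (A n m) ⟩
  A n m                             ∎
  where
  open ≡-Reasoning
  others : ∀ k → k ≤ n → k ≢ n → 𝒮^ 0 n k * A k m ≡ 0ℚ
  others k _ k≢n = trans (cong (λ t → ℕ→ℚ t * A k m) (Spow-zero-≢ (k≢n ∘ sym))) (ℚ.*-zeroˡ (A k m))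

·-identityʳ : ∀ (A : Matrix) → LowerTriangular A → ∀ n m → (A · 𝒮^ 0) n m ≡ A n m
·-identityʳ A A-lower n m with m ≤? n
... | yes m≤n = begin
  sumℚ n (λ k → A n k * 𝒮^ 0 k m)   ≡⟨ sumℚ-single n m≤n (λ k _ k≢m → off-diagonal k≢m) ⟩
  A n m * 𝒮^ 0 m m                  ≡⟨ cong (λ t → A n m * ℕ→ℚ t) (Spow-zero-≡ m) ⟩
  A n m * 1ℚ                        ≡⟨ ℚ.*-identityʳ (A n m) ⟩
  A n m                             ∎
  where
  open ≡-Reasoning
  off-diagonal : ∀ {k} → k ≢ m → A n k * 𝒮^ 0 k m ≡ 0ℚ
  off-diagonal {k} k≢m = trans (cong (λ t → A n k * ℕ→ℚ t) (Spow-zero-≢ k≢m)) (ℚ.*-zeroʳ (A n k))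
... | no m≰n = trans (sumℚ-zero n (λ k k≤n → trans (cong (A n k *_) (𝒮^-lowerTriangular 0 (≤-<-trans k≤n n<m)))
                                                    (ℚ.*-zeroʳ (A n k))))
                     (sym (A-lower n<m))
  where
  n<m : n < m
  n<m = ≰⇒> m≰n

𝒮-·-𝒮^ : ∀ p n m → (𝒮 · 𝒮^ p) n m ≡ (𝒮^ p · 𝒮) n m
𝒮-·-𝒮^ zero    n m = trans (·-identityʳ 𝒮 𝒮-lowerTriangular n m) (sym (·-identityˡ 𝒮 n m))
𝒮-·-𝒮^ (suc p) n m = begin
  (𝒮 · 𝒮^ (suc p)) n m     ≡⟨ sumℚ-cong n (λ k _ → cong (𝒮 n k *_) (𝒮^-suc p k m)) ⟩
  (𝒮 · (𝒮^ p · 𝒮)) n m     ≡⟨ ·-assoc 𝒮 (𝒮^ p) 𝒮 (𝒮^-lowerTriangular p) n m ⟩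
  ((𝒮 · 𝒮^ p) · 𝒮) n m     ≡⟨ sumℚ-cong n (λ j _ → cong (_* 𝒮 j m) (trans (𝒮-·-𝒮^ p n j) (sym (𝒮^-suc p n j)))) ⟩
  (𝒮^ (suc p) · 𝒮) n m     ∎
  where open ≡-Reasoning

-- Generating functions of the higher order Fubini polynomials

σ-constant : ∀ p → σ (suc p) 0 ≡ 0ℚ
σ-constant zero    = refl
σ-constant (suc p) = trans (cong (_* pow expm1 0 0) (σ-constant p)) (ℚ.*-zeroˡ (pow expm1 0 0))

pow-σ : ∀ p m n → pow (σ (suc p)) m n ≡ 𝒮^ (suc p) n m * ℕ→ℚ (m !) * inv! n
pow-σ zero    m n = trans (pow-expm1 m n)
  (cong (λ t → t * ℕ→ℚ (m !) * inv! n) (sym (trans (𝒮^-suc 0 n m) (·-identityˡ 𝒮 n m))))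
pow-σ (suc p) m n = begin
  pow (compose (σ (suc p)) expm1) m n
    ≡⟨ pow-compose {expm1} refl (σ (suc p)) m n ⟩
  sumℚ n (λ k → pow (σ (suc p)) m k * pow expm1 k n)
    ≡⟨ sumℚ-cong n (λ k _ → cong₂ _*_ (pow-σ p m k) (pow-expm1 k n)) ⟩
  sumℚ n (λ k → (𝒮^ (suc p) k m * M * inv! k) * (𝒮 n k * ℕ→ℚ (k !) * inv! n))
    ≡⟨ sumℚ-cong n (λ k _ → cancel-! k (𝒮^ (suc p) k m) (𝒮 n k)) ⟩
  sumℚ n (λ k → 𝒮 n k * 𝒮^ (suc p) k m * (M * inv! n))
    ≡⟨ sumℚ-*ʳ n (M * inv! n) (λ k → 𝒮 n k * 𝒮^ (suc p) k m) ⟨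
  (𝒮 · 𝒮^ (suc p)) n m * (M * inv! n)
    ≡⟨ cong (_* (M * inv! n)) (trans (𝒮-·-𝒮^ (suc p) n m) (sym (𝒮^-suc (suc p) n m))) ⟩
  𝒮^ (suc (suc p)) n m * (M * inv! n)
    ≡⟨ ℚ.*-assoc (𝒮^ (suc (suc p)) n m) M (inv! n) ⟨
  𝒮^ (suc (suc p)) n m * M * inv! n
    ∎
  where
  open ≡-Reasoning
  M : ℚ
  M = ℕ→ℚ (m !)
  rearrange : ∀ a M i s c j → (a * M * i) * (s * c * j) ≡ s * a * (M * j) * (i * c)
  rearrange = solve-∀ ℚ-ring
  cancel-! : ∀ k a s → (a * M * inv! k) * (s * ℕ→ℚ (k !) * inv! n) ≡ s * a * (M * inv! n)
  cancel-! k a s = trans (rearrange a M (inv! k) s (ℕ→ℚ (k !)) (inv! n))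
    (trans (cong (s * a * (M * inv! n) *_) (inv!-*-! k)) (ℚ.*-identityʳ (s * a * (M * inv! n))))

powers : FPS → BiFPS
powers g n k = pow g k n

FubiniEGF-powers : ∀ p i j → FubiniEGF (suc p) i j ≡ powers (σ (suc p)) i j
FubiniEGF-powers p i j with j ≤? i
... | yes j≤i = trans (cong (_* inv! i) (ℕ→ℚ-* (Spow (suc p) i j) (j !))) (sym (pow-σ p j i))
... | no j≰i  = trans (ℚ.*-zeroˡ (inv! i)) (sym (pow-vanishes (σ-constant p) j (≰⇒> j≰i)))

⊛₂-congˡ : ∀ {A A′ : BiFPS} (B : BiFPS) → (∀ i j → A i j ≡ A′ i j) → ∀ n k → (A ⊛₂ B) n k ≡ (A′ ⊛₂ B) n k
⊛₂-congˡ B A≗A′ n k = sumℚ-cong n λ i _ → sumℚ-cong k λ j _ → cong (_* B (n ∸ i) (k ∸ j)) (A≗A′ i j)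

one₂-zero : ∀ m → one₂ m 0 ≡ one m
one₂-zero zero    = refl
one₂-zero (suc m) = refl

one₂-suc : ∀ m k → one₂ m (suc k) ≡ 0ℚ
one₂-suc zero    k = refl
one₂-suc (suc m) k = refl

oneMinusXσ-high : ∀ p m {l} → 2 ≤ l → oneMinusXσ p m l ≡ 0ℚ
oneMinusXσ-high p m (s≤s (s≤s _)) = refl

powers-⊛₂-oneMinusXσ : ∀ p n k → (powers (σ p) ⊛₂ oneMinusXσ p) n k ≡ one₂ n k
powers-⊛₂-oneMinusXσ p n zero = begin
  sumℚ n (λ i → one i * one₂ (n ∸ i) 0)   ≡⟨ ⊛-congʳ one one₂-zero n ⟩
  (one ⊛ one) n                          ≡⟨ ⊛-identityˡ one n ⟩
  one n                                  ≡⟨ one₂-zero n ⟨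
  one₂ n 0                               ∎
  where open ≡-Reasoning
powers-⊛₂-oneMinusXσ p n (suc k) = begin
  sumℚ n (λ i → sumℚ (suc k) (λ j → pow g j i * oneMinusXσ p (n ∸ i) (suc k ∸ j)))
    ≡⟨ sumℚ-cong n (λ i _ → coefficient i) ⟩
  sumℚ n (λ i → pow g k i * (0ℚ - g (n ∸ i)) + pow g (suc k) i * one (n ∸ i))
    ≡⟨ sumℚ-+ n _ _ ⟩
  (pow g k ⊛ (λ i → 0ℚ - g i)) n + (pow g (suc k) ⊛ one) n
    ≡⟨ cong₂ _+_ (⊛-negateʳ (pow g k) g n) (trans (⊛-identityʳ (pow g (suc k)) n) (pow-suc-⊛ g k n)) ⟩
  (0ℚ - (pow g k ⊛ g) n) + (pow g k ⊛ g) n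
    ≡⟨ negate-+-cancel ((pow g k ⊛ g) n) ⟩
  0ℚ
    ≡⟨ one₂-suc n k ⟨
  one₂ n (suc k)
    ∎
  where
  open ≡-Reasoning
  g : FPS
  g = σ p
  negate-+-cancel : ∀ x → (0ℚ - x) + x ≡ 0ℚ
  negate-+-cancel = solve-∀ ℚ-ring
  coefficient : ∀ i → sumℚ (suc k) (λ j → pow g j i * oneMinusXσ p (n ∸ i) (suc k ∸ j))
                    ≡ pow g k i * (0ℚ - g (n ∸ i)) + pow g (suc k) i * one (n ∸ i)
  coefficient i = cong₂ _+_
    (trans (sumℚ-single k ≤-refl λ j j≤k j≢k → trans
              (cong (pow g j i *_) (oneMinusXσ-high p (n ∸ i) (2≤1+k∸j (≤∧≢⇒< j≤k j≢k))))
              (ℚ.*-zeroʳ (pow g j i)))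
           (cong (λ l → pow g k i * oneMinusXσ p (n ∸ i) l) (m+n∸n≡m 1 k)))
    (trans (cong (λ l → pow g (suc k) i * oneMinusXσ p (n ∸ i) l) (n∸n≡0 k))
           (cong (pow g (suc k) i *_) (one₂-zero (n ∸ i))))
    where
    2≤1+k∸j : ∀ {j} → j < k → 2 ≤ suc k ∸ j
    2≤1+k∸j j<k = subst (2 ≤_) (sym (+-∸-assoc 1 (<⇒≤ j<k))) (s≤s (m<n⇒0<n∸m j<k))

proposition8 : (p : ℕ) → 1 ≤ p → (n k : ℕ) →
    (FubiniEGF p ⊛₂ oneMinusXσ p) n k ≡ one₂ n k
proposition8 (suc p) _ n k = begin
  (FubiniEGF (suc p) ⊛₂ oneMinusXσ (suc p)) n k        ≡⟨ ⊛₂-congˡ (oneMinusXσ (suc p)) (FubiniEGF-powers p) n k ⟩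
  (powers (σ (suc p)) ⊛₂ oneMinusXσ (suc p)) n k       ≡⟨ powers-⊛₂-oneMinusXσ (suc p) n k ⟩
  one₂ n k                                             ∎
  where open ≡-Reasoning
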